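{- Let $R$ be an integral domain with unit, $p,q\in R$ with $q\ne0$, and work in the field of fractions of $R$. Let $U=(U_n)$ with $U_0=0$, $U_1=1$, $U_n=pU_{n-1}-qU_{n-2}$, $T=(T_n)$ with $T_0=1$, $T_1=0$, $T_n=pT_{n-1}-qT_{n-2}$, and $x_n=U_n/U_{n-1}$ for $n\ge2$. Let $h,k$ be nonnegative integers and $g_n=kn+h$ for $n\ge0$ (equivalently $g_0=h$, $g_1=h+k$, $g_n=2g_{n-1}-g_{n-2}$). Then for all $n\ge2$, $$U_{g_n}=\frac{1}{q^{g_{n-2}}}\left(qU^2_{g_{n-1}}U_{g_{n-2}}+2T_{g_{n-1}}U_{g_{n-1}}T_{g_{n-2}}+pU^2_{g_{n-1}}T_{g_{n-2}}-U_{g_{n-2}}T^2_{g_{n-1}}\right),$$ $$T_{g_n}=\frac{1}{q^{g_{n-2}}}\left(T^2_{g_{n-1}}T_{g_{n-2}}+pT^2_{g_{n-1}}U_{g_{n-2}}-qT_{g_{n-2}}U^2_{g_{n-1}}+2qT_{g_{n-1}}U_{g_{n-1}}U_{g_{n-2}}\right),$$ and (whenever the $x$'s involved are defined and the denominator is nonzero) $$x_{g_n}=\frac{x^2_{g_{n-1}}x_{g_{n-2}}+2qx_{g_{n-1}}-px^2_{g_{n-1}}-qx_{g_{n-2}}}{q-px_{g_{n-2}}-x^2_{g_{n-1}}+2x_{g_{n-1}}x_{g_{n-2}}}.$$ -}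

module Defs where

open import Level using (_⊔_)
open import Algebra.Bundles using (CommutativeRing)
open import Data.Nat using (ℕ; zero; suc; _≤_; pred)
import Data.Nat
open import Data.Sum using (_⊎_; inj₁; inj₂)
open import Data.Empty using (⊥)
open import Relation.Nullary using (¬_)

record IsIntegralDomain {c ℓ} (R : CommutativeRing c ℓ) : Set (c ⊔ ℓ) where
  open CommutativeRing R
  field
    1≉0          : ¬ (1# ≈ 0#)
    zero-product : ∀ x y → x * y ≈ 0# → (x ≈ 0#) ⊎ (y ≈ 0#)

module FieldOfFractions {c ℓ} (R : CommutativeRing c ℓ) (D : IsIntegralDomain R) where
  open CommutativeRing R
  open IsIntegralDomain D

  *-nonzero : ∀ {x y} → ¬ (x ≈ 0#) → ¬ (y ≈ 0#) → ¬ (x * y ≈ 0#)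
  *-nonzero {x} {y} x≉0 y≉0 xy≈0 with zero-product x y xy≈0
  ... | inj₁ e = x≉0 e
  ... | inj₂ e = y≉0 e

  record Frac : Set (c ⊔ ℓ) where
    constructor frac
    field
      num    : Carrier
      den    : Carrier
      den≉0  : ¬ (den ≈ 0#)
  open Frac public

  infix 4 _≈F_
  _≈F_ : Frac → Frac → Set ℓ
  a ≈F b = num a * den b ≈ num b * den a

  ι : Carrier → Frac
  ι r = frac r 1# 1≉0

  0F 1F : Frac
  0F = ι 0#
  1F = ι 1#

  infixl 6 _+F_ _-F_
  infixl 7 _*F_ _/F_

  _+F_ : Frac → Frac → Frac
  a +F b = frac (num a * den b + num b * den a) (den a * den b) (*-nonzero (den≉0 a) (den≉0 b))

  -F_ : Frac → Frac
  -F a = frac (- num a) (den a) (den≉0 a)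

  _-F_ : Frac → Frac → Frac
  a -F b = a +F (-F b)

  _*F_ : Frac → Frac → Frac
  a *F b = frac (num a * num b) (den a * den b) (*-nonzero (den≉0 a) (den≉0 b))

  _/F_ : (a b : Frac) → ¬ (b ≈F 0F) → Frac
  (a /F b) b≉0 =
    frac (num a * den b) (den a * num b)
         (*-nonzero (den≉0 a) (λ e → b≉0 (trans (*-identityʳ (num b)) (trans e (sym (zeroˡ (den b)))))))

module Lucas {c ℓ} (R : CommutativeRing c ℓ) (D : IsIntegralDomain R) (p q : CommutativeRing.Carrier R) where
  open CommutativeRing R
  open FieldOfFractions R D

  two : Carrier
  two = 1# + 1#

  U : ℕ → Carrier
  U zero = 0#
  U (suc zero) = 1#
  U (suc (suc n)) = p * U (suc n) - q * U n

  T : ℕ → Carrier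
  T zero = 1#
  T (suc zero) = 0#
  T (suc (suc n)) = p * T (suc n) - q * T n

  pow : Carrier → ℕ → Carrier
  pow x zero = 1#
  pow x (suc m) = x * pow x m

  pow-nonzero : ∀ {x} → ¬ (x ≈ 0#) → ∀ m → ¬ (pow x m ≈ 0#)
  pow-nonzero x≉0 zero = IsIntegralDomain.1≉0 D
  pow-nonzero x≉0 (suc m) = *-nonzero x≉0 (pow-nonzero x≉0 m)

  ι-nonzero : ∀ {r} → ¬ (r ≈ 0#) → ¬ (ι r ≈F 0F)
  ι-nonzero r≉0 e = r≉0 (trans (sym (*-identityʳ _)) (trans e (zeroˡ 1#)))

  x : (m : ℕ) → 2 ≤ m → ¬ (U (pred m) ≈ 0#) → Frac
  x m _ U≉0 = (ι (U m) /F ι (U (pred m))) (ι-nonzero U≉0)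

lin : ℕ → ℕ → ℕ → ℕ
lin h k n = k Data.Nat.* n Data.Nat.+ h

-- Let ω be a root of X² - pX + q and ω̄ = p - ω the other one.  In
-- R[ω] = R[X]/(X² - pX + q) one has ωⁿ = Tₙ + Uₙω, hence ω^(m+n) = ωᵐ ωⁿ (the
-- addition formulas) and ω̄ⁿ ωⁿ = qⁿ (the norm).  If a + m = 2b, as for the
-- three consecutive values a = g(n-2), b = g(n-1), m = g(n), then
--     qᵃ ωᵐ = ω̄ᵃ ωᵃ ωᵐ = ω̄ᵃ ω^(2b) = ω̄ᵃ (ωᵇ)²,
-- and the two components of this doubling identity are the formulas for U_m
-- and T_m.  Substituting Tⱼ = -q Uⱼ₋₁ in both components and dividing one by
-- the other gives the formula for x_m.
module Submission where

open import Defs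
open import Algebra.Bundles using (CommutativeRing; RawRing)
open import Data.Nat using (ℕ; zero; suc; _≤_; _∸_; pred; s≤s)
import Data.Nat as ℕ
import Data.Nat.Properties as ℕ
open import Data.Nat.Tactic.RingSolver using (solve-∀)
open import Data.Integer as ℤ using (ℤ; +_; -[1+_]; _⊖_; _◃_; sign; ∣_∣)
import Data.Integer.Properties as ℤ
open import Data.Sign as Sign using (Sign)
open import Data.Maybe using (Maybe; just; nothing)
open import Data.Product using (_×_; _,_; proj₁; proj₂)
open import Data.Product.Relation.Binary.Pointwise.NonDependent using (×-setoid)
open import Data.Sum using (inj₁; inj₂)
open import Data.Empty using (⊥-elim)
open import Relation.Nullary using (¬_; yes; no)
open import Relation.Binary.PropositionalEquality using (_≡_)
import Relation.Binary.PropositionalEquality as ≡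
open import Algebra.Solver.Ring.AlmostCommutativeRing
  using (_-Raw-AlmostCommutative⟶_; fromCommutativeRing)
open import Relation.Binary.Bundles using (Setoid)
import Relation.Binary.Reasoning.Setoid as Reasoning
import Data.Fin as Fin

-- The integers map into every commutative ring R (n ↦ n·1).  This map is a
-- homomorphism of raw rings, so the standard ring solver can be run over R
-- with integer coefficients; this is what lets it cancel terms like 1 - 1.
module IntegerCoefficients {c ℓ} (R : CommutativeRing c ℓ) where
  open CommutativeRing R
  open import Algebra.Properties.Ring ring using (-‿distribˡ-*; -‿distribʳ-*)
  open import Algebra.Properties.AbelianGroup +-abelianGroup
    using (⁻¹-∙-comm; ⁻¹-involutive; ε⁻¹≈ε)
  open import Algebra.Properties.CommutativeSemigroup +-commutativeSemigroup
    using (interchange)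
  open import Algebra.Properties.Semiring.Mult.TCOptimised semiring
    using (×-homo-+; ×1-homo-*) renaming (_×_ to _×ₙ_)
  open import Relation.Binary.Reasoning.Setoid setoid

  nat : ℕ → Carrier
  nat n = n ×ₙ 1#

  nat-suc : ∀ n → nat (suc n) ≈ 1# + nat n
  nat-suc n = ×-homo-+ 1# 1 n

  int : ℤ → Carrier
  int (+ n)    = nat n
  int -[1+ n ] = - nat (suc n)

  int-⊖ : ∀ m n → int (m ⊖ n) ≈ nat m - nat n
  int-⊖ m       zero    = sym (trans (+-congˡ ε⁻¹≈ε) (+-identityʳ _))
  int-⊖ zero    (suc n) = sym (+-identityˡ _)
  int-⊖ (suc m) (suc n) = begin
    int (suc m ⊖ suc n)             ≡⟨ ≡.cong int (ℤ.[1+m]⊖[1+n]≡m⊖n m n) ⟩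
    int (m ⊖ n)                     ≈⟨ int-⊖ m n ⟩
    nat m - nat n                   ≈⟨ +-identityˡ _ ⟨
    0# + (nat m - nat n)            ≈⟨ +-congʳ (-‿inverseʳ 1#) ⟨
    (1# - 1#) + (nat m - nat n)     ≈⟨ interchange 1# (- 1#) (nat m) (- nat n) ⟩
    (1# + nat m) + (- 1# - nat n)   ≈⟨ +-cong (nat-suc m) (trans (-‿cong (nat-suc n)) (sym (⁻¹-∙-comm 1# (nat n)))) ⟨
    nat (suc m) - nat (suc n)       ∎

  int-+ : ∀ i j → int (i ℤ.+ j) ≈ int i + int j
  int-+ (+ m)    (+ n)    = ×-homo-+ 1# m n
  int-+ (+ m)    -[1+ n ] = int-⊖ m (suc n)
  int-+ -[1+ m ] (+ n)    = trans (int-⊖ n (suc m)) (+-comm _ _)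
  int-+ -[1+ m ] -[1+ n ] = begin
    - nat (suc (suc (m ℕ.+ n)))    ≡⟨ ≡.cong (λ k → - nat (suc k)) (ℕ.+-suc m n) ⟨
    - nat (suc m ℕ.+ suc n)        ≈⟨ -‿cong (×-homo-+ 1# (suc m) (suc n)) ⟩
    - (nat (suc m) + nat (suc n))  ≈⟨ ⁻¹-∙-comm _ _ ⟨
    - nat (suc m) + - nat (suc n)  ∎

  -- Integer multiplication acts on signs and absolute values separately.
  signed : Sign → Carrier → Carrier
  signed Sign.+ r = r
  signed Sign.- r = - r

  signed-cong : ∀ s {r r′} → r ≈ r′ → signed s r ≈ signed s r′
  signed-cong Sign.+ eq = eq
  signed-cong Sign.- eq = -‿cong eq

  signed-* : ∀ s t r r′ → signed (s Sign.* t) (r * r′) ≈ signed s r * signed t r′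
  signed-* Sign.+ Sign.+ r r′ = refl
  signed-* Sign.+ Sign.- r r′ = -‿distribʳ-* r r′
  signed-* Sign.- Sign.+ r r′ = -‿distribˡ-* r r′
  signed-* Sign.- Sign.- r r′ = begin
    r * r′          ≈⟨ ⁻¹-involutive _ ⟨
    - - (r * r′)    ≈⟨ -‿cong (-‿distribˡ-* r r′) ⟩
    - (- r * r′)    ≈⟨ -‿distribʳ-* (- r) r′ ⟩
    - r * - r′      ∎

  int-◃ : ∀ s n → int (s ◃ n) ≈ signed s (nat n)
  int-◃ Sign.+ zero    = refl
  int-◃ Sign.- zero    = sym ε⁻¹≈ε
  int-◃ Sign.+ (suc n) = refl
  int-◃ Sign.- (suc n) = refl

  int-signAbs : ∀ i → int i ≈ signed (sign i) (nat ∣ i ∣)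
  int-signAbs (+ n)    = refl
  int-signAbs -[1+ n ] = refl

  int-* : ∀ i j → int (i ℤ.* j) ≈ int i * int j
  int-* i j = begin
    int (s ◃ ∣ i ∣ ℕ.* ∣ j ∣)                               ≈⟨ int-◃ s (∣ i ∣ ℕ.* ∣ j ∣) ⟩
    signed s (nat (∣ i ∣ ℕ.* ∣ j ∣))                         ≈⟨ signed-cong s (×1-homo-* ∣ i ∣ ∣ j ∣) ⟩
    signed s (nat ∣ i ∣ * nat ∣ j ∣)                         ≈⟨ signed-* (sign i) (sign j) _ _ ⟩
    signed (sign i) (nat ∣ i ∣) * signed (sign j) (nat ∣ j ∣) ≈⟨ *-cong (int-signAbs i) (int-signAbs j) ⟨
    int i * int j                                            ∎
    where s = sign i Sign.* sign j

  int-neg : ∀ i → int (ℤ.- i) ≈ - int i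
  int-neg (+ zero)  = sym ε⁻¹≈ε
  int-neg (+ suc n) = refl
  int-neg -[1+ n ]  = sym (⁻¹-involutive _)

  int-morphism : ℤ.+-*-rawRing -Raw-AlmostCommutative⟶ fromCommutativeRing R
  int-morphism = record
    { ⟦_⟧    = int
    ; +-homo = int-+
    ; *-homo = int-*
    ; -‿homo = int-neg
    ; 0-homo = refl
    ; 1-homo = refl
    }

  int-≟ : ∀ i j → Maybe (int i ≈ int j)
  int-≟ i j with i ℤ.≟ j
  ... | yes ≡.refl = just refl
  ... | no  _      = nothing

  open import Algebra.Solver.Ring ℤ.+-*-rawRing (fromCommutativeRing R) int-morphism int-≟ public

  -- Polynomial expressions in n variables, viewed as a raw ring, so that
  -- definitions written for an arbitrary raw ring can also be used as solver input.
  Expr : ℕ → RawRing _ _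
  Expr n = record
    { Carrier = Polynomial n ; _≈_ = _≡_
    ; _+_ = _:+_ ; _*_ = _:*_ ; -_ = :-_ ; 0# = con (+ 0) ; 1# = con (+ 1) }

-- Arithmetic in A[ω]/(ω² - pω + q) over a raw ring A: the element t + uω is the
-- pair (t , u).  With p, q the parameters of the Lucas sequences, the powers of
-- ω are ωⁿ = Tₙ + Uₙω.  Everything is written for a raw ring so that the same
-- definitions serve for actual ring elements and for solver expressions.
module QuadraticArithmetic {a ℓ} (A : RawRing a ℓ) (p q : RawRing.Carrier A) where
  open RawRing A

  infixl 6 _-_
  _-_ : Carrier → Carrier → Carrier
  x - y = x + - y

  Quad : Set a
  Quad = Carrier × Carrier

  infixl 7 _⊙_
  _⊙_ : Quad → Quad → Quad
  (t , u) ⊙ (t′ , u′) = t * t′ - q * u * u′ , t * u′ + u * t′ + p * u * u′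

  ω : Quad
  ω = 0# , 1#

  recur : Quad → Quad → Quad
  recur (t , u) (t′ , u′) = p * t - q * t′ , p * u - q * u′

  -- t + uω ↦ t + uω̄ with ω̄ = p - ω the other root; conj z ⊙ z = norm z
  conj : Quad → Quad
  conj (t , u) = t + p * u , - u

  norm : Quad → Carrier
  norm (t , u) = t * t + p * t * u + q * u * u

  scale : Carrier → Quad → Quad
  scale c (t , u) = c * t , c * u

-- Over solver expressions they compute the
-- numerator and denominator of a fraction-valued expression symbolically.
module FormalFractions {a ℓ} (A : RawRing a ℓ) where
  open RawRing A

  fractionRing : RawRing a ℓ
  fractionRing = record
    { Carrier = Carrier × Carrier
    ; _≈_ = λ (n , d) (n′ , d′) → n * d′ ≈ n′ * d
    ; _+_ = λ (n , d) (n′ , d′) → n * d′ + n′ * d , d * d′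
    ; _*_ = λ (n , d) (n′ , d′) → n * n′ , d * d′
    ; -_  = λ (n , d) → - n , d
    ; 0#  = 0# , 1#
    ; 1#  = 1# , 1#
    }

  embed : Carrier → Carrier × Carrier
  embed r = r , 1#

  infixl 7 _/_
  _/_ : Carrier × Carrier → Carrier × Carrier → Carrier × Carrier
  (n , d) / (n′ , d′) = n * d′ , d * n′

-- The right-hand sides of the three formulas of the proposition, over any raw
-- ring B containing the coefficients p, q and 2.  Instantiated in the field of
-- fractions they are the terms of the statement; over formal fractions of
-- solver expressions they let the solver clear their denominators.
module Formulas {a ℓ} (B : RawRing a ℓ) (p q two : RawRing.Carrier B) where
  open RawRing B

  infixl 6 _-_
  _-_ : Carrier → Carrier → Carrier
  x - y = x + - y

  U-rhs T-rhs : (Ua Ta Ub Tb : Carrier) → Carrier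
  U-rhs Ua Ta Ub Tb = q * Ub * Ub * Ua + two * Tb * Ub * Ta + p * Ub * Ub * Ta - Ua * Tb * Tb
  T-rhs Ua Ta Ub Tb = Tb * Tb * Ta + p * Tb * Tb * Ua - q * Ta * Ub * Ub + two * q * Tb * Ub * Ua

  x-numer x-denom : (xa xb : Carrier) → Carrier
  x-numer xa xb = xb * xb * xa + two * q * xb - p * xb * xb - q * xa
  x-denom xa xb = q - p * xa - xb * xb + two * xb * xa

  -- After substituting xⱼ = Uⱼ / uⱼ (where uⱼ = Uⱼ₋₁), x-numer and x-denom are
  -- these polynomials divided by u_b² u_a.
  clearedNum clearedDen : (Ua ua Ub ub : Carrier) → Carrier
  clearedNum Ua ua Ub ub = Ub * Ub * Ua + two * q * Ub * ub * ua - p * Ub * Ub * ua - q * Ua * ub * ub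
  clearedDen Ua ua Ub ub = q * ub * ub * ua - p * Ua * ub * ub - Ub * Ub * ua + two * Ub * Ua * ub

module Cancellation {c ℓ} (R : CommutativeRing c ℓ) (D : IsIntegralDomain R) where
  open CommutativeRing R
  open IsIntegralDomain D
  open import Algebra.Properties.Ring ring using (x[y-z]≈xy-xz; x∙y⁻¹≈ε⇒x≈y; x≈y⇒x∙y⁻¹≈ε)

  *-cancelˡ : ∀ {c x y} → ¬ (c ≈ 0#) → c * x ≈ c * y → x ≈ y
  *-cancelˡ {c} {x} {y} c≉0 eq with zero-product c (x - y) (trans (x[y-z]≈xy-xz c x y) (x≈y⇒x∙y⁻¹≈ε eq))
  ... | inj₁ c≈0   = ⊥-elim (c≉0 c≈0)
  ... | inj₂ x-y≈0 = x∙y⁻¹≈ε⇒x≈y x y x-y≈0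

module LucasProof {c ℓ} (R : CommutativeRing c ℓ) (D : IsIntegralDomain R)
                  (p q : CommutativeRing.Carrier R) where
  open CommutativeRing R hiding (zero)
  open FieldOfFractions R D
  open Lucas R D p q
  open Cancellation R D
  open IntegerCoefficients R using (solve; _:=_; _:+_; _:*_; :-_; _:^_; con; var; Polynomial; Expr)
  open QuadraticArithmetic rawRing p q
    using (Quad; _⊙_; ω; recur; conj; norm; scale)

  -- The same arithmetic on solver expressions, in which p and q are always the
  -- first two variables (the solver binds its variables in this order).
  open module Sym {n} = QuadraticArithmetic (Expr (suc (suc n))) (var Fin.zero) (var (Fin.suc Fin.zero))
    using () renaming (_⊙_ to _⊙ₚ_; recur to recurₚ; conj to conjₚ; norm to normₚ; scale to scaleₚ)

  0ₚ 1ₚ : ∀ {n} → Polynomial n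
  0ₚ = con (+ 0)
  1ₚ = con (+ 1)

  QuadSetoid : Setoid _ _
  QuadSetoid = ×-setoid setoid setoid

  infix 4 _≋_
  _≋_ : Quad → Quad → Set ℓ
  _≋_ = Setoid._≈_ QuadSetoid

  module ≋ = Setoid QuadSetoid
  module ≋-Reasoning = Reasoning QuadSetoid

  ⊙-cong : ∀ {z z′ w w′} → z ≋ z′ → w ≋ w′ → z ⊙ w ≋ z′ ⊙ w′
  ⊙-cong (t≈ , u≈) (t′≈ , u′≈) =
      +-cong (*-cong t≈ t′≈) (-‿cong (*-cong (*-congˡ u≈) u′≈))
    , +-cong (+-cong (*-cong t≈ u′≈) (*-cong u≈ t′≈)) (*-cong (*-congˡ u≈) u′≈)

  recur-cong : ∀ {z z′ w w′} → z ≋ z′ → w ≋ w′ → recur z w ≋ recur z′ w′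
  recur-cong (t≈ , u≈) (t′≈ , u′≈) =
    +-cong (*-congˡ t≈) (-‿cong (*-congˡ t′≈)) , +-cong (*-congˡ u≈) (-‿cong (*-congˡ u′≈))

  conj-cong : ∀ {z z′} → z ≋ z′ → conj z ≋ conj z′
  conj-cong (t≈ , u≈) = +-cong t≈ (*-congˡ u≈) , -‿cong u≈

  scale-cong : ∀ {c c′ z z′} → c ≈ c′ → z ≋ z′ → scale c z ≋ scale c′ z′
  scale-cong c≈ (t≈ , u≈) = *-cong c≈ t≈ , *-cong c≈ u≈

  norm-cong : ∀ {z z′} → z ≋ z′ → norm z ≈ norm z′
  norm-cong (t≈ , u≈) = +-cong (+-cong (*-cong t≈ t≈) (*-cong (*-congˡ t≈) u≈)) (*-cong (*-congˡ u≈) u≈)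

  ⊙-identityˡ : ∀ z → (1# , 0#) ⊙ z ≋ z
  ⊙-identityˡ (t , u) =
      solve 4 (λ p q t u → proj₁ ((1ₚ , 0ₚ) ⊙ₚ (t , u)) := t) refl p q t u
    , solve 4 (λ p q t u → proj₂ ((1ₚ , 0ₚ) ⊙ₚ (t , u)) := u) refl p q t u

  ⊙-comm : ∀ z w → z ⊙ w ≋ w ⊙ z
  ⊙-comm (t , u) (t′ , u′) =
      solve 6 (λ p q t u t′ u′ → proj₁ ((t , u) ⊙ₚ (t′ , u′)) := proj₁ ((t′ , u′) ⊙ₚ (t , u))) refl p q t u t′ u′
    , solve 6 (λ p q t u t′ u′ → proj₂ ((t , u) ⊙ₚ (t′ , u′)) := proj₂ ((t′ , u′) ⊙ₚ (t , u))) refl p q t u t′ u′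

  recur-⊙ : ∀ z w x → recur (z ⊙ x) (w ⊙ x) ≋ recur z w ⊙ x
  recur-⊙ (t , u) (t′ , u′) (t″ , u″) =
      solve 8 (λ p q t u t′ u′ t″ u″ → proj₁ (recurₚ ((t , u) ⊙ₚ (t″ , u″)) ((t′ , u′) ⊙ₚ (t″ , u″)))
                                      := proj₁ (recurₚ (t , u) (t′ , u′) ⊙ₚ (t″ , u″))) refl p q t u t′ u′ t″ u″
    , solve 8 (λ p q t u t′ u′ t″ u″ → proj₂ (recurₚ ((t , u) ⊙ₚ (t″ , u″)) ((t′ , u′) ⊙ₚ (t″ , u″)))
                                      := proj₂ (recurₚ (t , u) (t′ , u′) ⊙ₚ (t″ , u″))) refl p q t u t′ u′ t″ u″

  norm-⊙ω : ∀ z → norm (z ⊙ ω) ≈ q * norm z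
  norm-⊙ω (t , u) = solve 4 (λ p q t u → normₚ ((t , u) ⊙ₚ (0ₚ , 1ₚ)) := q :* normₚ (t , u)) refl p q t u

  norm-factor : ∀ z w → scale (norm z) w ≋ conj z ⊙ (z ⊙ w)
  norm-factor (t , u) (t′ , u′) =
      solve 6 (λ p q t u t′ u′ → proj₁ (scaleₚ (normₚ (t , u)) (t′ , u′))
                               := proj₁ (conjₚ (t , u) ⊙ₚ ((t , u) ⊙ₚ (t′ , u′)))) refl p q t u t′ u′
    , solve 6 (λ p q t u t′ u′ → proj₂ (scaleₚ (normₚ (t , u)) (t′ , u′))
                               := proj₂ (conjₚ (t , u) ⊙ₚ ((t , u) ⊙ₚ (t′ , u′)))) refl p q t u t′ u′

  -- ωⁿ = Tₙ + Uₙω: both sides satisfy the Lucas recurrence with the same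
  -- initial values 1 and ω.
  ω^ : ℕ → Quad
  ω^ n = T n , U n

  ω^-suc : ∀ n → ω^ (suc n) ≋ ω^ n ⊙ ω
  ω^-suc zero = ≋.sym (⊙-identityˡ ω)
  ω^-suc (suc zero) = solve 2 (λ p q → p :* 0ₚ :+ :- (q :* 1ₚ) := proj₁ ((0ₚ , 1ₚ) ⊙ₚ (0ₚ , 1ₚ))) refl p q
                    , solve 2 (λ p q → p :* 1ₚ :+ :- (q :* 0ₚ) := proj₂ ((0ₚ , 1ₚ) ⊙ₚ (0ₚ , 1ₚ))) refl p q
  ω^-suc (suc (suc n)) = ≋.trans (recur-cong (ω^-suc (suc n)) (ω^-suc n)) (recur-⊙ (ω^ (suc n)) (ω^ n) ω)

  ω^-+ : ∀ m n → ω^ (m ℕ.+ n) ≋ ω^ m ⊙ ω^ n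
  ω^-+ zero          n = ≋.sym (⊙-identityˡ (ω^ n))
  ω^-+ (suc zero)    n = ≋.trans (ω^-suc n) (⊙-comm (ω^ n) ω)
  ω^-+ (suc (suc m)) n =
    ≋.trans (recur-cong (ω^-+ (suc m) n) (ω^-+ m n)) (recur-⊙ (ω^ (suc m)) (ω^ m) (ω^ n))

  norm-ω^ : ∀ n → norm (ω^ n) ≈ pow q n
  norm-ω^ zero    = solve 2 (λ p q → normₚ (1ₚ , 0ₚ) := 1ₚ) refl p q
  norm-ω^ (suc n) = begin
    norm (ω^ (suc n))   ≈⟨ norm-cong (ω^-suc n) ⟩
    norm (ω^ n ⊙ ω)     ≈⟨ norm-⊙ω (ω^ n) ⟩
    q * norm (ω^ n)     ≈⟨ *-congˡ (norm-ω^ n) ⟩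
    q * pow q n         ∎
    where open Reasoning setoid

  T-shift : ∀ n → T (suc n) ≈ - q * U n
  T-shift n = trans (proj₁ (ω^-suc n))
    (solve 4 (λ p q t u → proj₁ ((t , u) ⊙ₚ (0ₚ , 1ₚ)) := :- q :* u) refl p q (T n) (U n))

  -- The key identity: if a + m = 2b then  qᵃ ωᵐ = ω̄ᵃ (ωᵇ)².
  -- Indeed qᵃ = ω̄ᵃ ωᵃ, and ωᵃ ωᵐ = ω^(a+m) = ω^(2b) = (ωᵇ)².
  doubling : ∀ a b m → a ℕ.+ m ≡ b ℕ.+ b → scale (pow q a) (ω^ m) ≋ conj (ω^ a) ⊙ (ω^ b ⊙ ω^ b)
  doubling a b m a+m≡2b = begin
    scale (pow q a) (ω^ m)            ≈⟨ scale-cong (sym (norm-ω^ a)) ≋.refl ⟩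
    scale (norm (ω^ a)) (ω^ m)        ≈⟨ norm-factor (ω^ a) (ω^ m) ⟩
    conj (ω^ a) ⊙ (ω^ a ⊙ ω^ m)       ≈⟨ ⊙-cong ≋.refl (ω^-+ a m) ⟨
    conj (ω^ a) ⊙ ω^ (a ℕ.+ m)        ≡⟨ ≡.cong (λ j → conj (ω^ a) ⊙ ω^ j) a+m≡2b ⟩
    conj (ω^ a) ⊙ ω^ (b ℕ.+ b)        ≈⟨ ⊙-cong ≋.refl (ω^-+ b b) ⟩
    conj (ω^ a) ⊙ (ω^ b ⊙ ω^ b)       ∎
    where open ≋-Reasoning

  FracRing : RawRing _ _
  FracRing = record
    { Carrier = Frac ; _≈_ = _≈F_ ; _+_ = _+F_ ; _*_ = _*F_ ; -_ = -F_ ; 0# = 0F ; 1# = 1F }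

  open Formulas FracRing (ι p) (ι q) (ι two) using (U-rhs; T-rhs; x-numer; x-denom)
  open Formulas rawRing p q two using (clearedNum; clearedDen)

  open module Fractionsₚ {n} = FormalFractions (Expr n) using (embed; _/_)
  open module Formulas/ₚ {n} = Formulas (FormalFractions.fractionRing (Expr (suc (suc n))))
      (embed (var Fin.zero)) (embed (var (Fin.suc Fin.zero))) (embed (1ₚ :+ 1ₚ))
    using () renaming (U-rhs to U-rhs/ₚ; T-rhs to T-rhs/ₚ; x-numer to x-numer/ₚ; x-denom to x-denom/ₚ)
  open module Formulasₚ {n} = Formulas (Expr (suc (suc n))) (var Fin.zero) (var (Fin.suc Fin.zero)) (1ₚ :+ 1ₚ)
    using () renaming (clearedNum to clearedNumₚ; clearedDen to clearedDenₚ)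

  ι≈F-scaled : ∀ {c x} (c≉0 : ¬ (c ≈ 0#)) (E : Frac) → c * x ≈ num E → den E ≈ 1# →
               ι x ≈F (1F /F ι c) (ι-nonzero c≉0) *F E
  ι≈F-scaled {c} {x} c≉0 E cx≈num den≈1 = begin
    x * ((1# * c) * den E)    ≈⟨ *-congˡ (*-congˡ den≈1) ⟩
    x * ((1# * c) * 1#)       ≈⟨ solve 2 (λ x c → x :* ((1ₚ :* c) :* 1ₚ) := c :* x) refl x c ⟩
    c * x                     ≈⟨ cx≈num ⟩
    num E                     ≈⟨ solve 1 (λ n → n := (1ₚ :* 1ₚ) :* n :* 1ₚ) refl (num E) ⟩
    (1# * 1#) * num E * 1#    ∎
    where open Reasoning setoid

  U-formula : (q≉0 : ¬ (q ≈ 0#)) (a b m : ℕ) → a ℕ.+ m ≡ b ℕ.+ b →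
    ι (U m) ≈F (1F /F ι (pow q a)) (ι-nonzero (pow-nonzero q≉0 a))
               *F U-rhs (ι (U a)) (ι (T a)) (ι (U b)) (ι (T b))
  U-formula q≉0 a b m a+m≡2b = ι≈F-scaled (pow-nonzero q≉0 a) (U-rhs (ι (U a)) (ι (T a)) (ι (U b)) (ι (T b)))
    (trans (proj₂ (doubling a b m a+m≡2b))
           (solve 6 (λ p q Ua Ta Ub Tb → proj₂ (conjₚ (Ta , Ua) ⊙ₚ ((Tb , Ub) ⊙ₚ (Tb , Ub)))
                                         := proj₁ (U-rhs/ₚ (embed Ua) (embed Ta) (embed Ub) (embed Tb)))
                  refl p q (U a) (T a) (U b) (T b)))
    (solve 6 (λ p q Ua Ta Ub Tb → proj₂ (U-rhs/ₚ (embed Ua) (embed Ta) (embed Ub) (embed Tb)) := 1ₚ)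
           refl p q (U a) (T a) (U b) (T b))

  T-formula : (q≉0 : ¬ (q ≈ 0#)) (a b m : ℕ) → a ℕ.+ m ≡ b ℕ.+ b →
    ι (T m) ≈F (1F /F ι (pow q a)) (ι-nonzero (pow-nonzero q≉0 a))
               *F T-rhs (ι (U a)) (ι (T a)) (ι (U b)) (ι (T b))
  T-formula q≉0 a b m a+m≡2b = ι≈F-scaled (pow-nonzero q≉0 a) (T-rhs (ι (U a)) (ι (T a)) (ι (U b)) (ι (T b)))
    (trans (proj₁ (doubling a b m a+m≡2b))
           (solve 6 (λ p q Ua Ta Ub Tb → proj₁ (conjₚ (Ta , Ua) ⊙ₚ ((Tb , Ub) ⊙ₚ (Tb , Ub)))
                                         := proj₁ (T-rhs/ₚ (embed Ua) (embed Ta) (embed Ub) (embed Tb)))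
                  refl p q (U a) (T a) (U b) (T b)))
    (solve 6 (λ p q Ua Ta Ub Tb → proj₂ (T-rhs/ₚ (embed Ua) (embed Ta) (embed Ub) (embed Tb)) := 1ₚ)
           refl p q (U a) (T a) (U b) (T b))

  cross : ∀ {c x y a b} → c * x ≈ a → c * y ≈ b → a * y ≈ b * x
  cross {c} {x} {y} {a} {b} cx≈a cy≈b = begin
    a * y          ≈⟨ *-congʳ cx≈a ⟨
    c * x * y      ≈⟨ solve 3 (λ c x y → c :* x :* y := c :* y :* x) refl c x y ⟩
    c * y * x      ≈⟨ *-congʳ cy≈b ⟩
    b * x          ∎
    where open Reasoning setoid

  shifted : ∀ j → 1 ≤ j → ω^ j ≋ (- q * U (pred j) , U j)
  shifted (suc j) _ = T-shift j , refl

  -- In the doubling identity substitute T = -q u; its two components then read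
  -- qᵃ (-q u_m) = -q² clearedDen  and  qᵃ U_m = q clearedNum, and cross-multiplying
  -- leaves a common factor q² ≠ 0.
  x-cleared : ¬ (q ≈ 0#) → ∀ a b m → a ℕ.+ m ≡ b ℕ.+ b → 1 ≤ a → 1 ≤ b → 1 ≤ m →
    let Ua = U a ; ua = U (pred a) ; Ub = U b ; ub = U (pred b) in
    U m * clearedDen Ua ua Ub ub ≈ clearedNum Ua ua Ub ub * U (pred m)
  x-cleared q≉0 a b m a+m≡2b 1≤a 1≤b 1≤m = *-cancelˡ (*-nonzero q≉0 q≉0) (begin
    q * q * (Um * clearedDen Ua ua Ub ub)    ≈⟨ solve 7 (λ p q Um Ua ua Ub ub →
                                                   q :* q :* (Um :* clearedDenₚ Ua ua Ub ub)
                                                   := :- (proj₁ (conjₚ (:- q :* ua , Ua) ⊙ₚ ((:- q :* ub , Ub) ⊙ₚ (:- q :* ub , Ub))) :* Um))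
                                                 refl p q Um Ua ua Ub ub ⟩
    - (proj₁ Dz * Um)                        ≈⟨ -‿cong (cross (proj₁ scaled) (proj₂ scaled)) ⟩
    - (proj₂ Dz * (- q * um))                ≈⟨ solve 7 (λ p q um Ua ua Ub ub →
                                                   :- (proj₂ (conjₚ (:- q :* ua , Ua) ⊙ₚ ((:- q :* ub , Ub) ⊙ₚ (:- q :* ub , Ub))) :* (:- q :* um))
                                                   := q :* q :* (clearedNumₚ Ua ua Ub ub :* um))
                                                 refl p q um Ua ua Ub ub ⟩
    q * q * (clearedNum Ua ua Ub ub * um)    ∎)
    where
    open Reasoning setoid
    Um = U m ; um = U (pred m) ; Ua = U a ; ua = U (pred a) ; Ub = U b ; ub = U (pred b)
    z : ℕ → Quad
    z j = - q * U (pred j) , U j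
    Dz : Quad
    Dz = conj (z a) ⊙ (z b ⊙ z b)
    scaled : scale (pow q a) (z m) ≋ Dz
    scaled = ≋.trans (scale-cong refl (≋.sym (shifted m 1≤m)))
             (≋.trans (doubling a b m a+m≡2b)
                      (⊙-cong (conj-cong (shifted a 1≤a)) (⊙-cong (shifted b 1≤b) (shifted b 1≤b))))

  -- Written over
  -- the common denominator, both sides of the cross-multiplied equation are
  -- u_a³ u_b⁶ times the two sides of x-cleared.
  x-formula : ¬ (q ≈ 0#) → ∀ a b m → a ℕ.+ m ≡ b ℕ.+ b →
    (2≤a : 2 ≤ a) (2≤b : 2 ≤ b) (2≤m : 2 ≤ m)
    (ua : ¬ (U (pred a) ≈ 0#)) (ub : ¬ (U (pred b) ≈ 0#)) (um : ¬ (U (pred m) ≈ 0#)) →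
    let xa = x a 2≤a ua
        xb = x b 2≤b ub
    in (dnz : ¬ (x-denom xa xb ≈F 0F)) → x m 2≤m um ≈F (x-numer xa xb /F x-denom xa xb) dnz
  x-formula q≉0 a b m a+m≡2b 2≤a 2≤b 2≤m _ _ _ _ =
    trans (solve 8 (λ p q Um um Ua ua Ub ub →
                      let xa = embed Ua / embed ua ; xb = embed Ub / embed ub in
                      proj₁ (embed Um / embed um) :* proj₂ (x-numer/ₚ xa xb / x-denom/ₚ xa xb)
                      := ua :^ 3 :* ub :^ 6 :* (Um :* clearedDenₚ Ua ua Ub ub))
                   refl p q (U m) (U (pred m)) (U a) (U (pred a)) (U b) (U (pred b)))
   (trans (*-congˡ (x-cleared q≉0 a b m a+m≡2b (ℕ.<⇒≤ 2≤a) (ℕ.<⇒≤ 2≤b) (ℕ.<⇒≤ 2≤m)))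
          (solve 8 (λ p q Um um Ua ua Ub ub →
                      let xa = embed Ua / embed ua ; xb = embed Ub / embed ub in
                      ua :^ 3 :* ub :^ 6 :* (clearedNumₚ Ua ua Ub ub :* um)
                      := proj₁ (x-numer/ₚ xa xb / x-denom/ₚ xa xb) :* proj₂ (embed Um / embed um))
                   refl p q (U m) (U (pred m)) (U a) (U (pred a)) (U b) (U (pred b))))

progression : ∀ h k n → lin h k n ℕ.+ lin h k (suc (suc n)) ≡ lin h k (suc n) ℕ.+ lin h k (suc n)
progression h k n = arithmetic h k n
  where
  arithmetic : ∀ h k n → k ℕ.* n ℕ.+ h ℕ.+ (k ℕ.* suc (suc n) ℕ.+ h) ≡ k ℕ.* suc n ℕ.+ h ℕ.+ (k ℕ.* suc n ℕ.+ h)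
  arithmetic = solve-∀

proposition2p9 : ∀ {c ℓ} (R : CommutativeRing c ℓ) (D : IsIntegralDomain R)
  (p q : CommutativeRing.Carrier R)
  (q≉0 : ¬ (CommutativeRing._≈_ R q (CommutativeRing.0# R)))
  (h k : ℕ) (n : ℕ) → 2 ≤ n →
  let open CommutativeRing R
      open FieldOfFractions R D
      open Lucas R D p q
      g : ℕ → ℕ
      g = lin h k
      a = g (n ∸ 2)
      b = g (n ∸ 1)
      m = g n
      invq = (1F /F ι (pow q a)) (ι-nonzero (pow-nonzero q≉0 a))
  in (ι (U m) ≈F invq *F (ι q *F ι (U b) *F ι (U b) *F ι (U a)
                         +F ι two *F ι (T b) *F ι (U b) *F ι (T a)
                         +F ι p *F ι (U b) *F ι (U b) *F ι (T a)
                         -F ι (U a) *F ι (T b) *F ι (T b)))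
   × (ι (T m) ≈F invq *F (ι (T b) *F ι (T b) *F ι (T a)
                         +F ι p *F ι (T b) *F ι (T b) *F ι (U a)
                         -F ι q *F ι (T a) *F ι (U b) *F ι (U b)
                         +F ι two *F ι q *F ι (T b) *F ι (U b) *F ι (U a)))
   × ((2≤a : 2 ≤ a) (2≤b : 2 ≤ b) (2≤m : 2 ≤ m)
      (ua : ¬ (U (pred a) ≈ 0#)) (ub : ¬ (U (pred b) ≈ 0#)) (um : ¬ (U (pred m) ≈ 0#)) →
      let xa = x a 2≤a ua
          xb = x b 2≤b ub
          xm = x m 2≤m um
          numer = xb *F xb *F xa +F ι two *F ι q *F xb -F ι p *F xb *F xb -F ι q *F xa
          denom = ι q -F ι p *F xa -F xb *F xb +F ι two *F xb *F xa
      in (dnz : ¬ (denom ≈F 0F)) → xm ≈F (numer /F denom) dnz)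
proposition2p9 R D p q q≉0 h k (suc (suc n)) (s≤s (s≤s _)) =
    U-formula q≉0 a b m a+m≡2b
  , T-formula q≉0 a b m a+m≡2b
  , x-formula q≉0 a b m a+m≡2b
  where
  open LucasProof R D p q
  a = lin h k n
  b = lin h k (suc n)
  m = lin h k (suc (suc n))
  a+m≡2b : a ℕ.+ m ≡ b ℕ.+ b
  a+m≡2b = progression h k n
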